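{- For a weakly graded poset $P$, the following are equivalent: (I) $P$ is $(\mathbf{3+1})$-avoiding; (II) $P$ is vigilant and every two elements $v,w$ with $\operatorname{rk}(w)-\operatorname{rk}(v)\ge 2$ are comparable; (III) $P$ is vigilant and every two elements $v,w$ with $\operatorname{rk}(w)-\operatorname{rk}(v)=2$ are comparable.
   Context: All posets are finite. A poset $P$ is weakly graded if there is a function $\operatorname{rk}:P\to\mathbb{N}$ (the rank function) such that $\operatorname{rk}(b)=\operatorname{rk}(a)+1$ whenever $b$ covers $a$, and such that the minimum value of $\operatorname{rk}$ on each connected component of $P$ is $0$. Write $P(i)$ for the set of elements of rank $i$. An element $v$ of rank $i$ is up-seeing if every element of $P(i+1)$ covers $v$, and down-seeing if $v$ covers every element of $P(i-1)$ (these conditions hold vacuously if the relevant rank set is empty). $P$ is vigilant if every element is up-seeing or down-seeing (or both). A poset is $(\mathbf{3+1})$-avoiding if there are no four elements $x,y,z,w$ with $x<y<z$ and $w$ incomparable to each of $x,y,z$. -}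

module Defs where

open import Level using (0ℓ)
open import Data.Nat using (ℕ; suc; _+_) renaming (_≤_ to _≤ℕ_)
open import Data.Fin using (Fin)
open import Data.Product using (Σ; ∃; _×_; _,_)
open import Data.Sum using (_⊎_)
open import Relation.Nullary using (¬_)
open import Relation.Binary using (IsPartialOrder; Decidable)
open import Relation.Binary.PropositionalEquality using (_≡_; _≢_)
open import Relation.Binary.Construct.Closure.ReflexiveTransitive using (Star)

record FinPoset : Set₁ where
  field
    size      : ℕ
    _≼_       : Fin size → Fin size → Set
    isPartialOrder : IsPartialOrder _≡_ _≼_
    _≼?_      : Decidable _≼_

module _ (P : FinPoset) where
  open FinPoset P

  El : Set
  El = Fin size

  _≺_ : El → El → Set
  a ≺ b = a ≼ b × a ≢ b

  _⋖_ : El → El → Set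
  a ⋖ b = a ≺ b × ¬ (∃ λ c → a ≺ c × c ≺ b)

  Comparable : El → El → Set
  Comparable a b = a ≼ b ⊎ b ≼ a

  Incomparable : El → El → Set
  Incomparable a b = ¬ Comparable a b

  Connected : El → El → Set
  Connected = Star Comparable

  IsRankFunction : (El → ℕ) → Set
  IsRankFunction rk =
    (∀ a b → a ⋖ b → rk b ≡ suc (rk a)) ×
    (∀ a → ∃ λ b → Connected a b × rk b ≡ 0)

  WeaklyGraded : Set
  WeaklyGraded = Σ (El → ℕ) IsRankFunction

  module _ (rk : El → ℕ) where
    UpSeeing : El → Set
    UpSeeing v = ∀ u → rk u ≡ suc (rk v) → v ⋖ u

    DownSeeing : El → Set
    DownSeeing v = ∀ u → suc (rk u) ≡ rk v → u ⋖ v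

    Vigilant : Set
    Vigilant = ∀ v → UpSeeing v ⊎ DownSeeing v

  Avoids3+1 : Set
  Avoids3+1 = ¬ (∃ λ x → ∃ λ y → ∃ λ z → ∃ λ w →
                  x ≺ y × y ≺ z ×
                  Incomparable w x × Incomparable w y × Incomparable w z)

-- Ranks strictly increase along ≺, so between comparable elements every intermediate rank is
-- attained.  (II) ⇒ (I): if w is incomparable to x ≺ y ≺ z, comparability at rank distance ≥ 2
-- pins rk w to rk x + 1 = rk z - 1, and w sees z (up) or x (down).  (I) ⇒ (II): walking through
-- the component of w towards a rank-0 element yields a 3-chain at ranks 0, 1, 2, whose bottom
-- must lie below w once rk w ≥ 2; a chain below w at ranks rk v, rk v + 1 then forms a (3+1)
-- with an incomparable v.  (I) ⇒ vigilance: a vertex v that sees neither way has t ⋠ v one rank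
-- below and v ⋠ u one rank above; t ≼ u by (II), and the element between them at rank rk v
-- completes a (3+1) with v.  (III) ⇒ (II): every element of rank k + 2 lies above one of rank
-- k + 1, so comparability propagates by induction on the rank distance.
module Submission where

open import Defs hiding (_≺_; _⋖_)
open import Data.Nat using (ℕ; zero; suc; _+_; _≤_; _<_; _∸_; z≤n; s≤s; z<s; _≤?_)
open import Data.Nat.Properties
open import Data.Fin.Properties using (any?) renaming (_≟_ to _≟ᶠ_)
open import Data.Fin.Induction using (po-wellFounded; po-noetherian)
open import Data.Product using (_×_; proj₁; proj₂; _,_; ∃; ∃₂; uncurry)
open import Data.Sum using (_⊎_; inj₁; inj₂; swap; [_,_]′)
open import Data.Empty using (⊥-elim)
open import Function using (_∘_; flip)
open import Function.Bundles using (_⇔_; mk⇔)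
open import Induction.WellFounded using (Acc; acc)
open import Relation.Nullary using (¬_; yes; no)
open import Relation.Nullary.Decidable using (_×-dec_; ¬?; decidable-stable)
open import Relation.Binary using (IsPartialOrder; Decidable)
open import Relation.Binary.PropositionalEquality
  using (_≡_; refl; sym; trans; cong; subst; subst₂; module ≡-Reasoning)
open import Relation.Binary.Construct.Closure.ReflexiveTransitive using (ε; _◅_)
import Relation.Binary.Construct.NonStrictToStrict as ToStrict

module Order (P : FinPoset) where
  open FinPoset P
  open IsPartialOrder isPartialOrder using () renaming (refl to ≼-refl; trans to ≼-trans)

  infix 4 _≺_ _⋖_

  _≺_ : El P → El P → Set
  _≺_ = Defs._≺_ P

  _⋖_ : El P → El P → Set
  _⋖_ = Defs._⋖_ P

  _≺?_ : Decidable _≺_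
  _≺?_ = ToStrict.<-decidable _≡_ _≼_ _≟ᶠ_ _≼?_

  ≺⇒≼-⋖ : ∀ {p q} → p ≺ q → ∃ λ c → p ≼ c × c ⋖ q
  ≺⇒≼-⋖ {p} {q} = go (po-noetherian isPartialOrder p)
    where
      go : ∀ {p} → Acc (flip _≺_) p → p ≺ q → ∃ λ c → p ≼ c × c ⋖ q
      go {p} (acc rs) p≺q with any? (λ x → (p ≺? x) ×-dec (x ≺? q))
      ... | no nothing-between = p , ≼-refl , p≺q , nothing-between
      ... | yes (x , p≺x , x≺q) with go (rs p≺x) x≺q
      ...   | c , x≼c , c⋖q = c , ≼-trans (proj₁ p≺x) x≼c , c⋖q

  module Ranked (rk : El P → ℕ) (rk-⋖ : ∀ p q → p ⋖ q → rk q ≡ suc (rk p)) where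

    ≺⇒rk< : ∀ {p q} → p ≺ q → rk p < rk q
    ≺⇒rk< {p} {q} = go (po-wellFounded isPartialOrder q)
      where
        go : ∀ {q} → Acc _≺_ q → p ≺ q → rk p < rk q
        go {q} (acc rs) p≺q with ≺⇒≼-⋖ p≺q
        ... | c , p≼c , c⋖q with p ≟ᶠ c
        ...   | yes refl = ≤-reflexive (sym (rk-⋖ p q c⋖q))
        ...   | no p≢c = <-trans (go (rs (proj₁ c⋖q)) (p≼c , p≢c)) (≤-reflexive (sym (rk-⋖ c q c⋖q)))

    ≼⇒rk≤ : ∀ {p q} → p ≼ q → rk p ≤ rk q
    ≼⇒rk≤ {p} {q} p≼q with p ≟ᶠ q
    ... | yes refl = ≤-refl
    ... | no p≢q = <⇒≤ (≺⇒rk< (p≼q , p≢q))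

    ≼∧rk≤⇒≡ : ∀ {p q} → p ≼ q → rk q ≤ rk p → p ≡ q
    ≼∧rk≤⇒≡ {p} {q} p≼q rkq≤rkp with p ≟ᶠ q
    ... | yes p≡q = p≡q
    ... | no p≢q = ⊥-elim (<⇒≱ (≺⇒rk< (p≼q , p≢q)) rkq≤rkp)

    ≼∧rk<⇒≺ : ∀ {p q} → p ≼ q → rk p < rk q → p ≺ q
    ≼∧rk<⇒≺ p≼q rkp<rkq = p≼q , λ { refl → <-irrefl refl rkp<rkq }

    ≼∧rk≡1+⇒⋖ : ∀ {p q} → p ≼ q → rk q ≡ suc (rk p) → p ⋖ q
    ≼∧rk≡1+⇒⋖ p≼q rkq≡1+rkp =
      ≼∧rk<⇒≺ p≼q (≤-reflexive (sym rkq≡1+rkp)) ,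
      λ { (c , p≺c , c≺q) →
            <⇒≱ (≺⇒rk< p≺c) (≤-pred (subst (suc (rk c) ≤_) rkq≡1+rkp (≺⇒rk< c≺q))) }

    comparable∧rk<⇒≼ : ∀ {p q} → Comparable P p q → rk p < rk q → p ≼ q
    comparable∧rk<⇒≼ (inj₁ p≼q) _ = p≼q
    comparable∧rk<⇒≼ (inj₂ q≼p) rkp<rkq = ⊥-elim (<⇒≱ rkp<rkq (≼⇒rk≤ q≼p))

    intermediate-at-depth : ∀ n {p q} → p ≼ q → rk p + n ≤ rk q →
                            ∃ λ e → p ≼ e × e ≼ q × rk e + n ≡ rk q
    intermediate-at-depth zero {q = q} p≼q _ = q , p≼q , ≼-refl , +-identityʳ (rk q)
    intermediate-at-depth (suc n) {p} {q} p≼q rkp+1+n≤rkq =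
      let c , p≼c , c⋖q = ≺⇒≼-⋖ p≺q
          rkq≡1+rkc = rk-⋖ c q c⋖q
          e , p≼e , e≼c , rke+n≡rkc =
            intermediate-at-depth n p≼c (≤-pred (subst₂ _≤_ (+-suc (rk p) n) rkq≡1+rkc rkp+1+n≤rkq))
      in e , p≼e , ≼-trans e≼c (proj₁ (proj₁ c⋖q)) , (begin
           rk e + suc n   ≡⟨ +-suc (rk e) n ⟩
           suc (rk e + n) ≡⟨ cong suc rke+n≡rkc ⟩
           suc (rk c)     ≡⟨ rkq≡1+rkc ⟨
           rk q           ∎)
      where
        open ≡-Reasoning
        p≺q : p ≺ q
        p≺q = ≼∧rk<⇒≺ p≼q (<-≤-trans (m<m+n (rk p) z<s) rkp+1+n≤rkq)

    intermediate : ∀ {p q} t → p ≼ q → rk p ≤ t → t ≤ rk q →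
                   ∃ λ e → p ≼ e × e ≼ q × rk e ≡ t
    intermediate {p} {q} t p≼q rkp≤t t≤rkq =
      let e , p≼e , e≼q , rke+d≡rkq = intermediate-at-depth d p≼q rkp+d≤rkq
      in e , p≼e , e≼q , +-cancelʳ-≡ d (rk e) t (trans rke+d≡rkq (sym t+d≡rkq))
      where
        d : ℕ
        d = rk q ∸ t
        t+d≡rkq : t + d ≡ rk q
        t+d≡rkq = m+[n∸m]≡n t≤rkq
        rkp+d≤rkq : rk p + d ≤ rk q
        rkp+d≤rkq = ≤-trans (+-monoˡ-≤ d rkp≤t) (≤-reflexive t+d≡rkq)

    chain-below : ∀ {p q} k → p ≼ q → rk p ≤ k → 2 + k ≤ rk q →
                  ∃₂ λ c d → c ≺ d × d ≺ q × rk c ≡ k × rk d ≡ suc k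
    chain-below {q = q} k p≼q rkp≤k 2+k≤rkq =
      let c , _ , c≼q , rkc≡k = intermediate k p≼q rkp≤k (≤-trans (n≤1+n k) (<⇒≤ 2+k≤rkq))
          d , c≼d , d≼q , rkd≡1+k =
            intermediate (suc k) c≼q (≤-trans (≤-reflexive rkc≡k) (n≤1+n k)) (<⇒≤ 2+k≤rkq)
      in c , d ,
         ≼∧rk<⇒≺ c≼d (subst₂ _<_ (sym rkc≡k) (sym rkd≡1+k) ≤-refl) ,
         ≼∧rk<⇒≺ d≼q (subst (_< rk q) (sym rkd≡1+k) 2+k≤rkq) ,
         rkc≡k , rkd≡1+k

    incomparable-above : ∀ {x b y} → ¬ x ≼ b → x ≼ y → rk y ≤ rk b → Incomparable P b y
    incomparable-above x⋠b x≼y rky≤rkb (inj₁ b≼y) with ≼∧rk≤⇒≡ b≼y rky≤rkb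
    ... | refl = x⋠b x≼y
    incomparable-above x⋠b x≼y _ (inj₂ y≼b) = x⋠b (≼-trans x≼y y≼b)

    incomparable-below : ∀ {a b y} → ¬ a ≼ b → y ≼ b → rk a ≤ rk y → Incomparable P a y
    incomparable-below a⋠b y≼b _ (inj₁ a≼y) = a⋠b (≼-trans a≼y y≼b)
    incomparable-below a⋠b y≼b rka≤rky (inj₂ y≼a) with ≼∧rk≤⇒≡ y≼a rka≤rky
    ... | refl = a⋠b y≼b

    upSeeing-or-blocked : ∀ v → UpSeeing P rk v ⊎ ∃ λ u → rk u ≡ suc (rk v) × ¬ v ≼ u
    upSeeing-or-blocked v with any? (λ u → (rk u ≟ suc (rk v)) ×-dec ¬? (v ≼? u))
    ... | yes blocked = inj₂ blocked
    ... | no unblocked = inj₁ λ u rku≡1+rkv →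
      ≼∧rk≡1+⇒⋖ (decidable-stable (v ≼? u) λ v⋠u → unblocked (u , rku≡1+rkv , v⋠u)) rku≡1+rkv

    downSeeing-or-blocked : ∀ v → DownSeeing P rk v ⊎ ∃ λ t → suc (rk t) ≡ rk v × ¬ t ≼ v
    downSeeing-or-blocked v with any? (λ t → (suc (rk t) ≟ rk v) ×-dec ¬? (t ≼? v))
    ... | yes blocked = inj₂ blocked
    ... | no unblocked = inj₁ λ t 1+rkt≡rkv →
      ≼∧rk≡1+⇒⋖ (decidable-stable (t ≼? v) λ t⋠v → unblocked (t , 1+rkt≡rkv , t⋠v))
                (sym 1+rkt≡rkv)

    ComparableAtDistance≥2 : Set
    ComparableAtDistance≥2 = ∀ v w → rk v + 2 ≤ rk w → Comparable P v w

    ComparableAtDistance2 : Set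
    ComparableAtDistance2 = ∀ v w → rk w ≡ rk v + 2 → Comparable P v w

    incomparable⇒rk≤1+ : ComparableAtDistance≥2 → ∀ {v w} → Incomparable P v w → rk w ≤ suc (rk v)
    incomparable⇒rk≤1+ comparable {v} {w} v#w with rk v + 2 ≤? rk w
    ... | yes rkv+2≤rkw = ⊥-elim (v#w (comparable v w rkv+2≤rkw))
    ... | no rkv+2≰rkw = ≤-pred (subst (rk w <_) (+-comm (rk v) 2) (≰⇒> rkv+2≰rkw))

    vigilant∧comparable⇒avoids : Vigilant P rk → ComparableAtDistance≥2 → Avoids3+1 P
    vigilant∧comparable⇒avoids vigilant comparable (x , y , z , w , x≺y , y≺z , w#x , _ , w#z)
      = [ (λ up → w#z (inj₁ (proj₁ (proj₁ (up z rkz≡1+rkw)))))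
        , (λ down → w#x (inj₂ (proj₁ (proj₁ (down x (sym rkw≡1+rkx))))))
        ]′ (vigilant w)
      where
        rkw≤1+rkx : rk w ≤ suc (rk x)
        rkw≤1+rkx = incomparable⇒rk≤1+ comparable (w#x ∘ swap)
        rkz≤1+rkw : rk z ≤ suc (rk w)
        rkz≤1+rkw = incomparable⇒rk≤1+ comparable w#z
        2+rkx≤rkz : 2 + rk x ≤ rk z
        2+rkx≤rkz = ≤-trans (s≤s (≺⇒rk< x≺y)) (≺⇒rk< y≺z)
        rkw≡1+rkx : rk w ≡ suc (rk x)
        rkw≡1+rkx = ≤-antisym rkw≤1+rkx (≤-pred (≤-trans 2+rkx≤rkz rkz≤1+rkw))
        rkz≡1+rkw : rk z ≡ suc (rk w)
        rkz≡1+rkw = ≤-antisym rkz≤1+rkw (≤-trans (s≤s (≤-reflexive rkw≡1+rkx)) 2+rkx≤rkz)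

  module Graded (G : WeaklyGraded P) where
    rk : El P → ℕ
    rk = proj₁ G

    open Ranked rk (proj₁ (proj₂ G)) public

    module _ (k : ℕ) where
      private
        ReachesHigh : El P → Set
        ReachesHigh x = ∃ λ c → x ≼ c × 2 + k ≤ rk c

        Straddle : Set
        Straddle = ∃₂ λ x c → x ≼ c × rk x ≤ k × 2 + k ≤ rk c

        -- Walking along comparabilities, either we straddle rank k or we still reach rank 2 + k;
        -- in the last case below, x ≼ x' with rk x' ≤ 1 + k ≤ rk x forces x = x'.
        step : ∀ {x x'} → Comparable P x x' → ReachesHigh x → Straddle ⊎ ReachesHigh x'
        step {x} {x'} x~x' (c , x≼c , 2+k≤rkc) with 2 + k ≤? rk x'
        ... | yes 2+k≤rkx' = inj₂ (x' , ≼-refl , 2+k≤rkx')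
        ... | no 2+k≰rkx' with x~x'
        ...   | inj₂ x'≼x = inj₂ (c , ≼-trans x'≼x x≼c , 2+k≤rkc)
        ...   | inj₁ x≼x' with rk x ≤? k
        ...     | yes rkx≤k = inj₁ (x , c , x≼c , rkx≤k , 2+k≤rkc)
        ...     | no rkx≰k = inj₂ (subst ReachesHigh (≼∧rk≤⇒≡ x≼x' rkx'≤rkx) (c , x≼c , 2+k≤rkc))
          where
            rkx'≤rkx : rk x' ≤ rk x
            rkx'≤rkx = ≤-trans (≤-pred (≰⇒> 2+k≰rkx')) (≰⇒> rkx≰k)

        walk : ∀ {x y} → Connected P x y → ReachesHigh x → rk y ≡ 0 → Straddle
        walk {x} ε (c , x≼c , 2+k≤rkc) rkx≡0 = x , c , x≼c , subst (_≤ k) (sym rkx≡0) z≤n , 2+k≤rkc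
        walk (x~x' ◅ path) high rky≡0 with step x~x' high
        ... | inj₁ straddle = straddle
        ... | inj₂ high' = walk path high' rky≡0

      rank-gap-pair : ∀ u → 2 + k ≤ rk u → ∃₂ λ x z → x ≼ z × rk x ≡ k × rk z ≡ 2 + k
      rank-gap-pair u 2+k≤rku =
        let b , u~b , rkb≡0 = proj₂ (proj₂ G) u
            x , c , x≼c , rkx≤k , 2+k≤rkc = walk u~b (u , ≼-refl , 2+k≤rku) rkb≡0
            e , _ , e≼c , rke≡k = intermediate k x≼c rkx≤k (≤-trans (m≤n+m k 2) 2+k≤rkc)
            z , e≼z , _ , rkz≡2+k =
              intermediate (2 + k) e≼c (subst (_≤ 2 + k) (sym rke≡k) (m≤n+m k 2)) 2+k≤rkc
        in e , z , e≼z , rke≡k , rkz≡2+k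

    avoids⇒rank-zero-below : Avoids3+1 P → ∀ {b} → 2 ≤ rk b → ∃ λ x → x ≼ b × rk x ≡ 0
    avoids⇒rank-zero-below avoids {b} 2≤rkb
      with rank-gap-pair 0 b 2≤rkb
    ... | x , z , x≼z , rkx≡0 , rkz≡2
      with chain-below 0 x≼z (≤-reflexive rkx≡0) (≤-reflexive (sym rkz≡2))
    ... | c , d , c≺d , d≺z , rkc≡0 , rkd≡1 with c ≼? b
    ...   | yes c≼b = c , c≼b , rkc≡0
    ...   | no c⋠b = ⊥-elim (avoids (c , d , z , b , c≺d , d≺z ,
              incomparable-above c⋠b ≼-refl (subst (_≤ rk b) (sym rkc≡0) z≤n) ,
              incomparable-above c⋠b (proj₁ c≺d) (subst (_≤ rk b) (sym rkd≡1) (<⇒≤ 2≤rkb)) ,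
              incomparable-above c⋠b (≼-trans (proj₁ c≺d) (proj₁ d≺z))
                (subst (_≤ rk b) (sym rkz≡2) 2≤rkb)))

    avoids⇒comparable≥2 : Avoids3+1 P → ComparableAtDistance≥2
    avoids⇒comparable≥2 avoids a b rka+2≤rkb with a ≼? b
    ... | yes a≼b = inj₁ a≼b
    ... | no a⋠b =
      let 2+rka≤rkb = subst (_≤ rk b) (+-comm (rk a) 2) rka+2≤rkb
          x , x≼b , rkx≡0 = avoids⇒rank-zero-below avoids (≤-trans (m≤m+n 2 (rk a)) 2+rka≤rkb)
          c , d , c≺d , d≺b , rkc≡rka , rkd≡1+rka =
            chain-below (rk a) x≼b (subst (_≤ rk a) (sym rkx≡0) z≤n) 2+rka≤rkb
      in ⊥-elim (avoids (c , d , b , a , c≺d , d≺b ,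
           incomparable-below a⋠b (≼-trans (proj₁ c≺d) (proj₁ d≺b)) (≤-reflexive (sym rkc≡rka)) ,
           incomparable-below a⋠b (proj₁ d≺b) (subst (rk a ≤_) (sym rkd≡1+rka) (n≤1+n (rk a))) ,
           incomparable-below a⋠b ≼-refl (≤-trans (m≤n+m (rk a) 2) 2+rka≤rkb)))

    avoids⇒vigilant : Avoids3+1 P → Vigilant P rk
    avoids⇒vigilant avoids v with upSeeing-or-blocked v | downSeeing-or-blocked v
    ... | inj₁ up | _ = inj₁ up
    ... | inj₂ _ | inj₁ down = inj₂ down
    ... | inj₂ (u , rku≡1+rkv , v⋠u) | inj₂ (t , 1+rkt≡rkv , t⋠v) =
      let s , t≼s , s≼u , rks≡rkv = intermediate (rk v) t≼u (<⇒≤ rkt<rkv) (<⇒≤ rkv<rku)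
      in ⊥-elim (avoids (t , s , u , v ,
           ≼∧rk<⇒≺ t≼s (subst (rk t <_) (sym rks≡rkv) rkt<rkv) ,
           ≼∧rk<⇒≺ s≼u (subst (_< rk u) (sym rks≡rkv) rkv<rku) ,
           incomparable-above t⋠v ≼-refl (<⇒≤ rkt<rkv) ,
           incomparable-above t⋠v t≼s (≤-reflexive rks≡rkv) ,
           incomparable-below v⋠u ≼-refl (<⇒≤ rkv<rku)))
      where
        rkt<rkv : rk t < rk v
        rkt<rkv = ≤-reflexive 1+rkt≡rkv
        rkv<rku : rk v < rk u
        rkv<rku = ≤-reflexive (sym rku≡1+rkv)
        rkt+2≡rku : rk t + 2 ≡ rk u
        rkt+2≡rku = trans (+-comm (rk t) 2) (sym (trans rku≡1+rkv (cong suc (sym 1+rkt≡rkv))))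
        t≼u : t ≼ u
        t≼u = comparable∧rk<⇒≼ (avoids⇒comparable≥2 avoids t u (≤-reflexive rkt+2≡rku))
                               (<-trans rkt<rkv rkv<rku)

    module _ (comparable₂ : ComparableAtDistance2) where
      comparable₂⇒lower-neighbour : ∀ {w} k → rk w ≡ 2 + k → ∃ λ f → f ≼ w × rk f ≡ suc k
      comparable₂⇒lower-neighbour {w} k rkw≡2+k =
        let x , _ , _ , rkx≡k , _ = rank-gap-pair k w (≤-reflexive (sym rkw≡2+k))
            rkx<rkw = subst₂ _<_ (sym rkx≡k) (sym rkw≡2+k) (n≤1+n (suc k))
            rkw≡rkx+2 = trans rkw≡2+k (trans (+-comm 2 k) (cong (_+ 2) (sym rkx≡k)))
            x≼w = comparable∧rk<⇒≼ (comparable₂ x w rkw≡rkx+2) rkx<rkw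
            f , _ , f≼w , rkf≡1+k = intermediate (suc k) x≼w (subst (_≤ suc k) (sym rkx≡k) (n≤1+n k))
                                      (subst (suc k ≤_) (sym rkw≡2+k) (n≤1+n (suc k)))
        in f , f≼w , rkf≡1+k

      comparable₂⇒≼ : ∀ d {v w} → rk w ≡ 2 + (d + rk v) → v ≼ w
      comparable₂⇒≼ zero {v} {w} rkw≡2+rkv =
        comparable∧rk<⇒≼ (comparable₂ v w (trans rkw≡2+rkv (+-comm 2 (rk v))))
                         (subst (rk v <_) (sym rkw≡2+rkv) (m<n+m (rk v) z<s))
      comparable₂⇒≼ (suc d) {v} rkw≡2+1+d+rkv =
        let f , f≼w , rkf≡2+d+rkv = comparable₂⇒lower-neighbour (suc (d + rk v)) rkw≡2+1+d+rkv
        in ≼-trans (comparable₂⇒≼ d rkf≡2+d+rkv) f≼w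

      comparable₂⇒comparable≥2 : ComparableAtDistance≥2
      comparable₂⇒comparable≥2 v w rkv+2≤rkw = inj₁ (comparable₂⇒≼ d rkw≡2+d+rkv)
        where
          open ≡-Reasoning
          d : ℕ
          d = rk w ∸ (2 + rk v)
          rkw≡2+d+rkv : rk w ≡ 2 + (d + rk v)
          rkw≡2+d+rkv = begin
            rk w                 ≡⟨ m∸n+n≡m (subst (_≤ rk w) (+-comm (rk v) 2) rkv+2≤rkw) ⟨
            d + (2 + rk v)       ≡⟨ +-suc d (suc (rk v)) ⟩
            suc (d + suc (rk v)) ≡⟨ cong suc (+-suc d (rk v)) ⟩
            2 + (d + rk v)       ∎

theorem3p1 : (P : FinPoset) → (G : WeaklyGraded P) →
    let rk = proj₁ G in
    (Avoids3+1 P ⇔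
    (Vigilant P rk × (∀ v w → rk v + 2 ≤ rk w → Comparable P v w))) ×
    (Avoids3+1 P ⇔
    (Vigilant P rk × (∀ v w → rk w ≡ rk v + 2 → Comparable P v w)))
theorem3p1 P G =
  mk⇔ (λ avoids → avoids⇒vigilant avoids , avoids⇒comparable≥2 avoids)
      (uncurry vigilant∧comparable⇒avoids) ,
  mk⇔ (λ avoids → avoids⇒vigilant avoids ,
                  λ v w rkw≡rkv+2 → avoids⇒comparable≥2 avoids v w (≤-reflexive (sym rkw≡rkv+2)))
      (λ (vigilant , comparable₂) →
         vigilant∧comparable⇒avoids vigilant (comparable₂⇒comparable≥2 comparable₂))
  where open Order.Graded P G
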